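{- Let $n=3$ and let $\vec\alpha \neq \vec\beta \in \mathbb{F}_2^n$. Let $\Pi$ be any reconfiguration sequence of functions $\mathbb{F}_2^n\to\mathbb{F}_2$ from $\mathrm{Had}(\vec\alpha)$ to $\mathrm{Had}(\vec\beta)$ such that every function $f$ in $\Pi$ satisfies $\min\{\Delta(f,\mathrm{Had}(\vec\alpha)),\Delta(f,\mathrm{Had}(\vec\beta))\}\le\frac14$. Then $\Pi$ contains a function $f^\circ$ with $\Delta(f^\circ,\mathrm{Had}(\vec\gamma)) \le \frac14$ for some $\vec\gamma \in \mathbb{F}_2^n\setminus\{\vec\alpha,\vec\beta\}$.
   Context: For $\vec\alpha \in \mathbb{F}_2^n$, $\mathrm{Had}(\vec\alpha):\mathbb{F}_2^n\to\mathbb{F}_2$ is the function $\vec x\mapsto\langle\vec\alpha,\vec x\rangle$. $\Delta(f,g)$ is the fraction of inputs on which $f$ and $g$ differ. A reconfiguration sequence from $f^{\mathsf{ini}}$ to $f^{\mathsf{tar}}$ is a finite sequence of functions starting at $f^{\mathsf{ini}}$, ending at $f^{\mathsf{tar}}$, with consecutive functions differing on at most one input. -}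

module Defs where

open import Data.Bool using (Bool; true; false; _xor_; _∧_; if_then_else_)
open import Data.Nat using (ℕ; zero; suc; _+_; _*_; _^_; _≤_)
open import Data.Fin using (Fin; zero; suc)
open import Data.List using (List; []; _∷_; map; last)
open import Data.Nat.ListAction using (sum)
open import Data.Vec using (Vec) renaming ([] to []ᵥ; _∷_ to _∷ᵥ_)
open import Data.List.Relation.Unary.All using (All)
open import Data.Maybe using (Maybe; just)
open import Relation.Binary.PropositionalEquality using (_≡_)
open import Data.Product using (_×_)
open import Data.Unit using (⊤)

-- 𝔽₂ is Bool (false = 0, true = 1, xor = +, ∧ = ·); 𝔽₂ⁿ is Vec Bool n.
Vecn : ℕ → Set
Vecn n = Vec Bool n

Fun : ℕ → Set
Fun n = Vecn n → Bool

inner : ∀ {n} → Vecn n → Vecn n → Bool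
inner []ᵥ []ᵥ = false
inner (a ∷ᵥ as) (x ∷ᵥ xs) = (a ∧ x) xor inner as xs

Had : ∀ {n} → Vecn n → Fun n
Had α x = inner α x

allVecs : (n : ℕ) → List (Vecn n)
allVecs zero = []ᵥ ∷ []
allVecs (suc n) = Data.List._++_ (map (false ∷ᵥ_) (allVecs n)) (map (true ∷ᵥ_) (allVecs n))

-- number of inputs on which f and g differ (so Δ(f,g) = dist f g / 2^n)
dist : ∀ {n} → Fun n → Fun n → ℕ
dist {n} f g = sum (map (λ x → if f x xor g x then 1 else 0) (allVecs n))

Δ≤¼ : ∀ {n} → Fun n → Fun n → Set
Δ≤¼ {n} f g = 4 * dist f g ≤ 2 ^ n

Steps : ∀ {n} → List (Fun n) → Set
Steps [] = ⊤
Steps (f ∷ []) = ⊤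
Steps {n} (f ∷ g ∷ fs) = (dist f g ≤ 1) × Steps {n} (g ∷ fs)

record IsReconfSeq {n} (fini ftar : Fun n) (Π : List (Fun n)) : Set where
  field
    startsAt : Data.List.head Π ≡ just fini
    endsAt   : last Π ≡ just ftar
    steps    : Steps Π

-- Measure each f in Π by its distances to Had α and Had β.  A single step moves f
-- by one input, so each distance changes by at most 1 and f cannot pass in one step
-- from being 2 closer to Had α to being 2 closer to Had β.  Since Π starts at Had α
-- and ends at Had β, some f in Π lies at nearly equal distance from both.  For n = 3
-- an exhaustive check over all 2⁸ functions shows that such an f, being within 1/4
-- of Had α or Had β, is within 1/4 of a third Hadamard codeword.
module Submission where

open import Defs
open import Data.Bool using (Bool; true; false; _xor_; if_then_else_)
open import Data.Bool.Properties using (xor-comm; xor-same) renaming (_≟_ to _≟ᵇ_)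
open import Data.Empty using (⊥-elim)
open import Data.List using (List; []; _∷_; map; last; cartesianProductWith)
open import Data.List.Membership.Propositional using (_∈_)
open import Data.List.Membership.Propositional.Properties
  using (∈-map⁺; ∈-++⁺ˡ; ∈-++⁺ʳ; ∈-cartesianProductWith⁺)
open import Data.List.Properties using (map-cong)
open import Data.List.Relation.Unary.All as All using (All; []; _∷_; all?)
open import Data.List.Relation.Unary.Any as Any using (Any; here; there; any?; satisfied)
open import Data.Maybe using (just)
open import Data.Nat using (ℕ; zero; suc; _+_; _*_; _^_; _≤_; _≤?_; z≤n; s≤s)
open import Data.Nat.ListAction using (sum)
open import Data.Nat.Properties
  using (≤-refl; ≤-reflexive; ≤-trans; +-mono-≤; +-monoˡ-≤; +-monoʳ-≤; +-assoc; +-comm;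
         +-cancelˡ-≤; m≤n+m; +-commutativeSemigroup; module ≤-Reasoning)
open import Algebra.Properties.CommutativeSemigroup +-commutativeSemigroup using (interchange)
open import Data.Product using (Σ; ∃-syntax; _×_; _,_; map₂)
open import Data.Sum using (_⊎_; inj₁; inj₂) renaming (map to map⊎)
open import Data.Vec using () renaming ([] to []ᵥ; _∷_ to _∷ᵥ_)
open import Data.Vec.Properties using (≡-dec)
open import Function using (_∘_)
open import Relation.Binary.PropositionalEquality
  using (_≡_; _≢_; _≗_; refl; sym; cong; subst; subst₂)
open import Relation.Nullary using (¬_; Dec; ¬?)
open import Relation.Nullary.Decidable using (_⊎-dec_; _×-dec_; _→-dec_; toWitness)

bit : Bool → ℕ
bit b = if b then 1 else 0

mismatches : ∀ {n} → Fun n → Fun n → List (Vecn n) → ℕ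
mismatches f g xs = sum (map (λ x → bit (f x xor g x)) xs)

mismatches-self : ∀ {n} (f : Fun n) xs → mismatches f f xs ≡ 0
mismatches-self f [] = refl
mismatches-self f (x ∷ xs) rewrite xor-same (f x) = mismatches-self f xs

bit-xor-triangle : ∀ p q r → bit (p xor r) ≤ bit (p xor q) + bit (q xor r)
bit-xor-triangle false false r = ≤-refl
bit-xor-triangle true  true  r = ≤-refl
bit-xor-triangle false true  false = z≤n
bit-xor-triangle false true  true  = ≤-refl
bit-xor-triangle true  false false = ≤-refl
bit-xor-triangle true  false true  = z≤n

mismatches-triangle : ∀ {n} (f g h : Fun n) xs →
  mismatches f h xs ≤ mismatches f g xs + mismatches g h xs
mismatches-triangle f g h [] = z≤n
mismatches-triangle f g h (x ∷ xs) =
  ≤-trans (+-mono-≤ (bit-xor-triangle (f x) (g x) (h x)) (mismatches-triangle f g h xs))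
          (≤-reflexive (interchange (bit (f x xor g x)) (bit (g x xor h x)) _ _))

dist-self : ∀ {n} (f : Fun n) → dist f f ≡ 0
dist-self {n} f = mismatches-self f (allVecs n)

dist-sym : ∀ {n} (f g : Fun n) → dist f g ≡ dist g f
dist-sym {n} f g = cong sum (map-cong (λ x → cong bit (xor-comm (f x) (g x))) (allVecs n))

dist-congˡ : ∀ {n} {f f′ : Fun n} (g : Fun n) → f ≗ f′ → dist f g ≡ dist f′ g
dist-congˡ {n} g f≗f′ = cong sum (map-cong (λ x → cong (λ b → bit (b xor g x)) (f≗f′ x)) (allVecs n))

dist-triangle : ∀ {n} (f g h : Fun n) → dist f h ≤ dist f g + dist g h
dist-triangle {n} f g h = mismatches-triangle f g h (allVecs n)

dist-step : ∀ {n} (f g h : Fun n) → dist f g ≤ 1 → dist f h ≤ 1 + dist g h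
dist-step f g h f~g = ≤-trans (dist-triangle f g h) (+-monoˡ-≤ (dist g h) f~g)

Leans : ∀ {n} → Fun n → Fun n → Fun n → Set
Leans a b f = dist f a + 2 ≤ dist f b

¬Leans-self : ∀ {n} (a f : Fun n) → ¬ Leans a f f
¬Leans-self a f h with ≤-trans (m≤n+m 2 (dist f a)) (≤-trans h (≤-reflexive (dist-self f)))
... | ()

Leans-no-swap : ∀ {n} (a b f g : Fun n) → dist f g ≤ 1 → Leans a b f → ¬ Leans b a g
Leans-no-swap a b f g f~g fa gb with +-cancelˡ-≤ (dist f a) 4 2 chain
  where
  open ≤-Reasoning
  chain : dist f a + 4 ≤ dist f a + 2
  chain = begin
    dist f a + 4        ≡⟨ +-assoc (dist f a) 2 2 ⟨
    dist f a + 2 + 2    ≤⟨ +-monoˡ-≤ 2 fa ⟩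
    dist f b + 2        ≤⟨ +-monoˡ-≤ 2 (dist-step f g b f~g) ⟩
    1 + dist g b + 2    ≡⟨ +-assoc 1 (dist g b) 2 ⟩
    1 + (dist g b + 2)  ≤⟨ +-monoʳ-≤ 1 gb ⟩
    1 + dist g a        ≤⟨ +-monoʳ-≤ 1 (dist-step g f a (subst (_≤ 1) (dist-sym f g) f~g)) ⟩
    2 + dist f a        ≡⟨ +-comm 2 (dist f a) ⟩
    dist f a + 2        ∎
... | s≤s (s≤s ())

module Crossing {n} {A B G : Fun n → Set}
                (no-jump : ∀ f g → dist f g ≤ 1 → A f → ¬ B g) where

  crossing-from : ∀ {t} f fs → Steps (f ∷ fs) → last (f ∷ fs) ≡ just t →
    All (λ h → A h ⊎ B h ⊎ G h) (f ∷ fs) → ¬ B f → ¬ A t → Any G (f ∷ fs)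
  crossing-from f [] _ refl (inj₁ af ∷ []) _ ¬At = ⊥-elim (¬At af)
  crossing-from f fs _ _ (inj₂ (inj₁ bf) ∷ _) ¬Bf _ = ⊥-elim (¬Bf bf)
  crossing-from f fs _ _ (inj₂ (inj₂ gf) ∷ _) _ _ = here gf
  crossing-from f (g ∷ fs) (f~g , steps) last≡ (inj₁ af ∷ cs) _ ¬At =
    there (crossing-from g fs steps last≡ cs (no-jump f g f~g af) ¬At)

  crossing : ∀ {s t Π} → IsReconfSeq s t Π →
    All (λ h → A h ⊎ B h ⊎ G h) Π → ¬ B s → ¬ A t → Any G Π
  crossing {Π = f ∷ fs} record { startsAt = refl ; endsAt = last≡ ; steps = steps } =
    crossing-from f fs steps last≡

allVecs-complete : ∀ {n} (v : Vecn n) → v ∈ allVecs n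
allVecs-complete []ᵥ = here refl
allVecs-complete (false ∷ᵥ v) = ∈-++⁺ˡ (∈-map⁺ (false ∷ᵥ_) (allVecs-complete v))
allVecs-complete {suc n} (true ∷ᵥ v) =
  ∈-++⁺ʳ (map (false ∷ᵥ_) (allVecs n)) (∈-map⁺ (true ∷ᵥ_) (allVecs-complete v))

glue : ∀ {n} → Fun n → Fun n → Fun (suc n)
glue f g (b ∷ᵥ x) = if b then g x else f x

allFuns : (n : ℕ) → List (Fun n)
allFuns zero = (λ _ → false) ∷ (λ _ → true) ∷ []
allFuns (suc n) = cartesianProductWith glue (allFuns n) (allFuns n)

allFuns-complete : ∀ {n} (f : Fun n) → ∃[ g ] g ∈ allFuns n × f ≗ g
allFuns-complete {zero} f with f []ᵥ in eq
... | false = _ , here refl , λ { []ᵥ → eq }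
... | true  = _ , there (here refl) , λ { []ᵥ → eq }
allFuns-complete {suc n} f
  with allFuns-complete (f ∘ (false ∷ᵥ_)) | allFuns-complete (f ∘ (true ∷ᵥ_))
... | g₀ , g₀∈ , f₀≗g₀ | g₁ , g₁∈ , f₁≗g₁ =
  glue g₀ g₁ , ∈-cartesianProductWith⁺ glue g₀∈ g₁∈ ,
  λ { (false ∷ᵥ x) → f₀≗g₀ x ; (true ∷ᵥ x) → f₁≗g₁ x }

_≟ᵥ_ : ∀ {n} (u v : Vecn n) → Dec (u ≡ v)
_≟ᵥ_ = ≡-dec _≟ᵇ_

Near : ∀ {n} → Vecn n → Vecn n → Fun n → Set
Near α β f = Δ≤¼ f (Had α) ⊎ Δ≤¼ f (Had β)

Third : ∀ {n} → Vecn n → Vecn n → Fun n → Vecn n → Set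
Third α β f γ = γ ≢ α × γ ≢ β × Δ≤¼ f (Had γ)

Trichotomy : ∀ {n} → Vecn n → Vecn n → Fun n → Set
Trichotomy {n} α β f =
  Leans (Had α) (Had β) f ⊎ Leans (Had β) (Had α) f ⊎ Any (Third α β f) (allVecs n)

trichotomy? : ∀ {n} α β (f : Fun n) → Dec (α ≢ β → Near α β f → Trichotomy α β f)
trichotomy? {n} α β f =
  ¬? (α ≟ᵥ β) →-dec (close? α ⊎-dec close? β) →-dec
  (leans? α β ⊎-dec leans? β α ⊎-dec any? third? (allVecs n))
  where
  close? : ∀ γ → Dec (Δ≤¼ f (Had γ))
  close? γ = 4 * dist f (Had γ) ≤? 2 ^ n
  leans? : ∀ a b → Dec (Leans (Had a) (Had b) f)
  leans? a b = dist f (Had a) + 2 ≤? dist f (Had b)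
  third? : ∀ γ → Dec (Third α β f γ)
  third? γ = ¬? (γ ≟ᵥ α) ×-dec ¬? (γ ≟ᵥ β) ×-dec close? γ

trichotomy-table : All (λ f → All (λ α → All (λ β → α ≢ β → Near α β f → Trichotomy α β f)
                     (allVecs 3)) (allVecs 3)) (allFuns 3)
trichotomy-table = toWitness {a? = all? (λ f → all? (λ α → all? (λ β → trichotomy? α β f)
                     (allVecs 3)) (allVecs 3)) (allFuns 3)} _

trichotomy : (α β : Vecn 3) → α ≢ β → (f : Fun 3) → Near α β f → Trichotomy α β f
trichotomy α β α≢β f near with allFuns-complete f
... | g , g∈ , f≗g =
  map⊎ (leans⇐ (Had α) (Had β))
       (map⊎ (leans⇐ (Had β) (Had α)) (Any.map (λ {γ} → map₂ (map₂ (close⇐ γ)))))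
       (table-entry α≢β (map⊎ (close⇒ α) (close⇒ β) near))
  where
  table-entry : α ≢ β → Near α β g → Trichotomy α β g
  table-entry = All.lookup (All.lookup (All.lookup trichotomy-table g∈)
                  (allVecs-complete α)) (allVecs-complete β)
  same : ∀ h → dist g h ≡ dist f h
  same h = sym (dist-congˡ h f≗g)
  close⇒ : ∀ γ → Δ≤¼ f (Had γ) → Δ≤¼ g (Had γ)
  close⇒ γ = subst (λ d → 4 * d ≤ 8) (sym (same (Had γ)))
  close⇐ : ∀ γ → Δ≤¼ g (Had γ) → Δ≤¼ f (Had γ)
  close⇐ γ = subst (λ d → 4 * d ≤ 8) (same (Had γ))
  leans⇐ : ∀ a b → Leans a b g → Leans a b f
  leans⇐ a b = subst₂ (λ d e → d + 2 ≤ e) (same a) (same b)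

mainTheorem4 : (α β : Vecn 3) → ¬ (α ≡ β) → (Π : List (Fun 3)) →
    IsReconfSeq (Had α) (Had β) Π →
    All (λ f → Δ≤¼ f (Had α) ⊎ Δ≤¼ f (Had β)) Π →
    Any (λ f → Σ (Vecn 3) (λ γ → ¬ (γ ≡ α) × ¬ (γ ≡ β) × Δ≤¼ f (Had γ))) Π
mainTheorem4 α β α≢β Π reconf near =
  Any.map satisfied
    (crossing reconf (All.map (λ {f} → trichotomy α β α≢β f) near)
              (¬Leans-self (Had β) (Had α)) (¬Leans-self (Had α) (Had β)))
  where
  open Crossing (Leans-no-swap (Had α) (Had β))
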